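{- In an alternative-cycle graph $ACG(\pi,\tau,f)$, all edges of any one cycle correspond to occurrences of a single symbol $a$: every red edge of the cycle is an occurrence of $a$ in $\pi$ and every blue edge of the cycle arises from an occurrence of $a$ in $\tau$.
   Context: Fix genes $\Sigma_1$ and repeats $\Sigma_2\ni r_0$. A chromosome is a sequence $\pi=[x_0,\dots,x_{n+1}]$ of signed symbols ($x_i=\pm a$, $|x_i|=a$) with $x_0=+r_0$, $x_{n+1}=-r_0$, every gene occurring exactly once. Nodes are labelled $(l(x_i),r(x_i))=(a^h,a^t)$ if $x_i=+a$, $(a^t,a^h)$ if $x_i=-a$. Adjacencies: unordered pairs $\langle r(x_i),l(x_{i+1})\rangle$ at the gaps $0\le i\le n$; $\mathcal{A}[\pi]$ is their multiset. Let $\pi,\tau$ be related chromosomes with $\mathcal{A}[\pi]=\mathcal{A}[\tau]$. $ACG(\pi,\tau,f)$: $f$ is a bijection between the gaps of $\pi$ and of $\tau$ sending each adjacency to an identical one (left end matched to left end, right end to right end). For each occurrence $x_i$ of $\pi$ create two distinct nodes $l(x_i),r(x_i)$ joined by a red edge. For each occurrence $y_k$ of $\tau$: among the nodes of $\pi$ bordering the gap matched to the left gap of $y_k$ take the one labelled $l(y_k)$, among those bordering the gap matched to the right gap of $y_k$ take the one labelled $r(y_k)$, and join them by a blue edge (this blue edge arises from $y_k$). The graph is a disjoint union of cycles alternating red and blue edges. -}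

module Defs where

open import Data.Nat using (ℕ; suc)
open import Data.Fin using (Fin; zero; suc; fromℕ; inject₁)
open import Data.Sum using (_⊎_; inj₁; inj₂)
open import Data.Product using (_×_; _,_; ∃; ∃!)
open import Data.Maybe using (Maybe; just; nothing; maybe)
import Data.Maybe as Maybe
open import Function.Bundles using (_↔_; Inverse)
open import Relation.Binary.PropositionalEquality using (_≡_)
open import Relation.Binary.Construct.Closure.ReflexiveTransitive using (Star)

Sym : Set → Set → Set
Sym Gene Repeat = Gene ⊎ Repeat

data Sign : Set where
  ⊕ ⊖ : Sign

record Signed (S : Set) : Set where
  constructor _·_
  field
    sign : Sign
    sym  : S
open Signed public

data End : Set where
  head tail : End

Extremity : Set → Set
Extremity S = S × End

l r : {S : Set} → Signed S → Extremity S
l (⊕ · a) = a , head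
l (⊖ · a) = a , tail
r (⊕ · a) = a , tail
r (⊖ · a) = a , head

-- A chromosome with n inner symbols: x₀ … x_{n+1}, given as a function on Fin (n+2).
IsChromosome : (Gene Repeat : Set) (r₀ : Repeat) (n : ℕ) →
               (Fin (suc (suc n)) → Signed (Sym Gene Repeat)) → Set
IsChromosome Gene Repeat r₀ n x =
  (x zero ≡ ⊕ · inj₂ r₀) ×
  (x (fromℕ (suc n)) ≡ ⊖ · inj₂ r₀) ×
  (∀ (g : Gene) → ∃! _≡_ (λ i → sym (x i) ≡ inj₁ g))

-- Gap i (0 ≤ i ≤ n) lies between x_i = x (inject₁ i) and x_{i+1} = x (suc i).
-- An ACG matching f: a bijection between gaps of π and of τ sending each
-- adjacency to an identical one, left end to left end, right end to right end.
record GapMatching {S : Set} (n m : ℕ)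
         (x : Fin (suc (suc n)) → Signed S)
         (y : Fin (suc (suc m)) → Signed S) : Set where
  field
    bij      : Fin (suc n) ↔ Fin (suc m)
    leftEnd  : ∀ i → r (x (inject₁ i)) ≡ r (y (inject₁ (Inverse.to bij i)))
    rightEnd : ∀ i → l (x (suc i))     ≡ l (y (suc (Inverse.to bij i)))
open GapMatching public

-- Nodes of ACG(π,τ,f): for each occurrence x_i two distinct nodes l(x_i), r(x_i).
data Side : Set where
  L R : Side

Node : ℕ → Set
Node n = Fin (suc (suc n)) × Side

data Edge (n m : ℕ) : Set where
  red  : Fin (suc (suc n)) → Edge n m
  blue : Fin (suc (suc m)) → Edge n m

-- last element split off: nothing for the last index, just k otherwise
splitLast : ∀ {m} → Fin (suc m) → Maybe (Fin m)
splitLast {ℕ.zero} zero = nothing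
splitLast {suc m} zero = just zero
splitLast {suc m} (suc i) = Maybe.map suc (splitLast i)

module ACG {S : Set} {n m : ℕ}
           (x : Fin (suc (suc n)) → Signed S)
           (y : Fin (suc (suc m)) → Signed S)
           (f : GapMatching n m x y) where

  from : Fin (suc m) → Fin (suc n)
  from = Inverse.from (bij f)

  -- Endpoint labelled l(y_k): the left gap of y_k is τ-gap k-1; l(y_k) is its
  -- right end, matched to the right end of π-gap g = f⁻¹(k-1), i.e. the node l(x_{g+1}).
  -- For k = 0 (no gap to the left) this is the node l(x₀).
  blueLeft : Fin (suc (suc m)) → Node n
  blueLeft zero    = zero , L
  blueLeft (suc k) = suc (from k) , L

  -- Endpoint labelled r(y_k): the right gap of y_k is τ-gap k; r(y_k) is its
  -- left end, matched to the left end of π-gap g = f⁻¹(k), i.e. the node r(x_g).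
  -- For k = m+1 (no gap to the right) this is the node r(x_{n+1}).
  blueRight : Fin (suc (suc m)) → Node n
  blueRight k = maybe (λ g → inject₁ (from g) , R) (fromℕ (suc n) , R) (splitLast k)

  data Incident : Edge n m → Node n → Set where
    red-l  : ∀ i → Incident (red i) (i , L)
    red-r  : ∀ i → Incident (red i) (i , R)
    blue-l : ∀ k → Incident (blue k) (blueLeft k)
    blue-r : ∀ k → Incident (blue k) (blueRight k)

  Touch : Edge n m → Edge n m → Set
  Touch e e' = ∃ λ v → Incident e v × Incident e' v

  -- e and e' lie on the same cycle (= connected component) of ACG(π,τ,f)
  SameCycle : Edge n m → Edge n m → Set
  SameCycle = Star Touch

  EdgeOf : S → Edge n m → Set
  EdgeOf a (red i)  = sym (x i) ≡ a
  EdgeOf a (blue k) = sym (y k) ≡ a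

module Submission where

open import Defs
open import Data.Nat using (ℕ; suc)
open import Data.Fin using (Fin; zero; suc; fromℕ; inject₁)
open import Data.Product using (∃; _,_; proj₁)
open import Data.Maybe using (just; nothing)
open import Function.Base using (_on_)
open import Function.Bundles using (Inverse)
open import Relation.Binary.PropositionalEquality as ≡ using (_≡_; refl; cong; module ≡-Reasoning)
open import Relation.Binary.Construct.Closure.ReflexiveTransitive using (fold)

-- Every node of the graph is an extremity of some occurrence x_i, and every edge
-- joins two extremities carrying the symbol of that edge's occurrence: for red
-- edges trivially, for blue edges because the gap matching preserves labels and
-- the two chromosomes share their end symbols ±r₀. Hence adjacent edges carry
-- the same symbol, and so do all edges of a cycle.

splitLast-nothing⇒fromℕ : ∀ {m} (k : Fin (suc m)) → splitLast k ≡ nothing → k ≡ fromℕ m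
splitLast-nothing⇒fromℕ {ℕ.zero} zero    _ = refl
splitLast-nothing⇒fromℕ {suc m}  (suc k) eq with splitLast k in e
... | nothing = cong suc (splitLast-nothing⇒fromℕ k e)

splitLast-just⇒inject₁ : ∀ {m} (k : Fin (suc m)) {g} → splitLast k ≡ just g → inject₁ g ≡ k
splitLast-just⇒inject₁ {suc m} zero    refl = refl
splitLast-just⇒inject₁ {suc m} (suc k) eq with splitLast k in e
splitLast-just⇒inject₁ {suc m} (suc k) refl | just g = cong suc (splitLast-just⇒inject₁ k e)

sym-l : ∀ {S : Set} (z : Signed S) → proj₁ (l z) ≡ sym z
sym-l (⊕ · a) = refl
sym-l (⊖ · a) = refl

sym-r : ∀ {S : Set} (z : Signed S) → proj₁ (r z) ≡ sym z
sym-r (⊕ · a) = refl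
sym-r (⊖ · a) = refl

module ACGSymbols {S : Set} {n m : ℕ}
                  (x : Fin (suc (suc n)) → Signed S)
                  (y : Fin (suc (suc m)) → Signed S)
                  (f : GapMatching n m x y)
                  (sym-first : sym (x zero) ≡ sym (y zero))
                  (sym-last  : sym (x (fromℕ (suc n))) ≡ sym (y (fromℕ (suc m))))
                  where

  open ACG x y f

  nodeSymbol : Node n → S
  nodeSymbol (i , _) = sym (x i)

  edgeSymbol : Edge n m → S
  edgeSymbol (red i)  = sym (x i)
  edgeSymbol (blue k) = sym (y k)

  to∘from : ∀ k → Inverse.to (bij f) (from k) ≡ k
  to∘from = Inverse.strictlyInverseˡ (bij f)

  nodeSymbol-blueLeft : ∀ k → nodeSymbol (blueLeft k) ≡ sym (y k)
  nodeSymbol-blueLeft zero    = sym-first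
  nodeSymbol-blueLeft (suc k) = begin
    sym (x (suc (from k)))                            ≡⟨ ≡.sym (sym-l (x (suc (from k)))) ⟩
    proj₁ (l (x (suc (from k))))                      ≡⟨ cong proj₁ (rightEnd f (from k)) ⟩
    proj₁ (l (y (suc (Inverse.to (bij f) (from k))))) ≡⟨ cong (λ j → proj₁ (l (y (suc j)))) (to∘from k) ⟩
    proj₁ (l (y (suc k)))                             ≡⟨ sym-l (y (suc k)) ⟩
    sym (y (suc k))                                   ∎
    where open ≡-Reasoning

  nodeSymbol-blueRight : ∀ k → nodeSymbol (blueRight k) ≡ sym (y k)
  nodeSymbol-blueRight k with splitLast k in e
  ... | nothing = ≡.trans sym-last (cong (λ j → sym (y j)) (≡.sym (splitLast-nothing⇒fromℕ k e)))
  ... | just g = begin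
    sym (x (inject₁ (from g)))                            ≡⟨ ≡.sym (sym-r (x (inject₁ (from g)))) ⟩
    proj₁ (r (x (inject₁ (from g))))                      ≡⟨ cong proj₁ (leftEnd f (from g)) ⟩
    proj₁ (r (y (inject₁ (Inverse.to (bij f) (from g))))) ≡⟨ cong (λ j → proj₁ (r (y (inject₁ j)))) (to∘from g) ⟩
    proj₁ (r (y (inject₁ g)))                             ≡⟨ sym-r (y (inject₁ g)) ⟩
    sym (y (inject₁ g))                                   ≡⟨ cong (λ j → sym (y j)) (splitLast-just⇒inject₁ k e) ⟩
    sym (y k)                                             ∎
    where open ≡-Reasoning

  Incident⇒nodeSymbol≡edgeSymbol : ∀ {e v} → Incident e v → nodeSymbol v ≡ edgeSymbol e
  Incident⇒nodeSymbol≡edgeSymbol (red-l i)  = refl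
  Incident⇒nodeSymbol≡edgeSymbol (red-r i)  = refl
  Incident⇒nodeSymbol≡edgeSymbol (blue-l k) = nodeSymbol-blueLeft k
  Incident⇒nodeSymbol≡edgeSymbol (blue-r k) = nodeSymbol-blueRight k

  Touch⇒edgeSymbol≡ : ∀ {e e′} → Touch e e′ → edgeSymbol e ≡ edgeSymbol e′
  Touch⇒edgeSymbol≡ (_ , inc , inc′) =
    ≡.trans (≡.sym (Incident⇒nodeSymbol≡edgeSymbol inc)) (Incident⇒nodeSymbol≡edgeSymbol inc′)

  SameCycle⇒edgeSymbol≡ : ∀ {e e′} → SameCycle e e′ → edgeSymbol e ≡ edgeSymbol e′
  SameCycle⇒edgeSymbol≡ = fold (_≡_ on edgeSymbol) (λ t q → ≡.trans (Touch⇒edgeSymbol≡ t) q) refl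

  edgeSymbol≡⇒EdgeOf : ∀ e {a} → edgeSymbol e ≡ a → EdgeOf a e
  edgeSymbol≡⇒EdgeOf (red i)  eq = eq
  edgeSymbol≡⇒EdgeOf (blue k) eq = eq

  cycle-single-symbol : ∀ e₀ → ∃ λ a → ∀ e → SameCycle e₀ e → EdgeOf a e
  cycle-single-symbol e₀ = edgeSymbol e₀ , λ e p →
    edgeSymbol≡⇒EdgeOf e (≡.sym (SameCycle⇒edgeSymbol≡ p))

lemma10 : (Gene Repeat : Set) (r₀ : Repeat) (n m : ℕ)
          (x : Fin (suc (suc n)) → Signed (Sym Gene Repeat))
          (y : Fin (suc (suc m)) → Signed (Sym Gene Repeat)) →
          IsChromosome Gene Repeat r₀ n x →
          IsChromosome Gene Repeat r₀ m y →
          (f : GapMatching n m x y) →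
          (e₀ : Edge n m) →
          ∃ λ (a : Sym Gene Repeat) →
            ∀ (e : Edge n m) → ACG.SameCycle x y f e₀ e → ACG.EdgeOf x y f a e
lemma10 Gene Repeat r₀ n m x y (x-first , x-last , _) (y-first , y-last , _) f =
  ACGSymbols.cycle-single-symbol x y f
    (≡.trans (cong sym x-first) (≡.sym (cong sym y-first)))
    (≡.trans (cong sym x-last) (≡.sym (cong sym y-last)))
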